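{- The hybrid logic $\mathbf{IB(@)}$ is decidable; that is, there is an algorithm that decides, for any hybrid formula $\varphi$, whether $\varphi$ is true at every world of every orthomodel.
   Context: Hybrid language: fix disjoint countably infinite sets $\mathbf{Prop}$ (propositional variables) and $\mathbf{Nom}$ (nominals). Formulas: $\varphi ::= p \mid i \mid \neg\varphi \mid \varphi\land\varphi \mid \diamondsuit\varphi \mid @_i\varphi$ with $p\in\mathbf{Prop}$, $i\in\mathbf{Nom}$. A model is $(W,R,V)$ with $W\neq\emptyset$, $R\subseteq W\times W$, $V:\mathbf{Prop}\cup\mathbf{Nom}\to\mathcal{P}(W)$ with $V(i)=\{i^V\}$ a singleton for each nominal $i$. Satisfaction: $w\models p$ iff $w\in V(p)$; $w\models i$ iff $w=i^V$; Boolean clauses as usual; $w\models\diamondsuit\varphi$ iff some $v$ with $wRv$ has $v\models\varphi$; $w\models @_i\varphi$ iff $i^V\models\varphi$. An orthoframe is a frame $(W,R)$ with $R$ irreflexive and symmetric; an orthomodel is a model on an orthoframe. $\mathbf{IB(@)}$ is the hybrid logic of the class of all orthoframes (axiomatically: the basic hybrid logic $\mathbf{K(@)}$ plus the axioms $@_i\neg\diamondsuit i$ and $@_i\square\diamondsuit i$, where $\square\varphi=\neg\diamondsuit\neg\varphi$). -}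

module Defs where

open import Data.Nat using (ℕ)
open import Data.Product using (Σ; _×_)
open import Data.Empty using (⊥)
open import Relation.Nullary using (¬_)
open import Relation.Binary.PropositionalEquality using (_≡_)

-- Propositional variables and nominals: two disjoint countably infinite sets,
-- both indexed by ℕ (disjointness is enforced by the separate constructors below).
Prop : Set
Prop = ℕ

Nom : Set
Nom = ℕ

data Form : Set where
  var  : Prop → Form
  nom  : Nom → Form
  neg  : Form → Form
  and  : Form → Form → Form
  dia  : Form → Form
  at   : Nom → Form → Form

-- Kripke models (W,R,V) with V(i) = {i^V} a singleton for each nominal i
-- (represented by the point i^V = nomV i).
record Model : Set₁ where
  field
    W    : Set
    w₀   : W
    R    : W → W → Set
    V    : Prop → W → Set
    nomV : Nom → W

record IsOrtho (M : Model) : Set where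
  open Model M
  field
    irrefl : ∀ w → ¬ R w w
    sym    : ∀ {w v} → R w v → R v w

record Orthomodel : Set₁ where
  field
    model   : Model
    isOrtho : IsOrtho model
  open Model model public

-- Classical satisfaction, rendered constructively via the
-- Gödel–Gentzen double-negation translation (atoms and ◇ are ¬¬-wrapped),
-- so that satisfaction is the usual classical (two-valued) one.
_,_⊨_ : (M : Model) → Model.W M → Form → Set
M , w ⊨ var p   = ¬ ¬ Model.V M p w
M , w ⊨ nom i   = ¬ ¬ (w ≡ Model.nomV M i)
M , w ⊨ neg φ   = ¬ (M , w ⊨ φ)
M , w ⊨ and φ ψ = (M , w ⊨ φ) × (M , w ⊨ ψ)
M , w ⊨ dia φ   = ¬ ¬ (Σ (Model.W M) λ v → Model.R M w v × (M , v ⊨ φ))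
M , w ⊨ at i φ  = M , Model.nomV M i ⊨ φ

IBValid : Form → Set₁
IBValid φ = (M : Orthomodel) → (w : Orthomodel.W M) → Orthomodel.model M , w ⊨ φ

{-# OPTIONS --safe #-}
-- Filtration through the subformulas of φ.  The type of a world is the set of
-- subformulas it satisfies.  Given an orthomodel, link two types when worlds of
-- these types are related (a symmetric relation, as R is symmetric), and let each
-- nominal denote the type of the world it names.  To keep the filtrated relation
-- irreflexive every type comes in two copies, and a type is linked to itself only
-- across the copies.  The second copy of a type containing a true nominal is left
-- isolated, as the nominal holds at a single world; but that type is realised by
-- one world only, which is not related to itself, so it never needs the copy.
-- The truth lemma (proved classically, satisfaction being ¬¬-stable) then shows
-- that φ is valid iff it holds in all small orthomodels determined by a table of
-- links and a table of denotations on types.  These are finitely many finite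
-- models, so exhaustive search decides validity.
module Submission where

open import Defs
open import Level using (0ℓ)
open import Data.Bool using (Bool; true; false; not; T)
open import Data.Bool.Properties using (not-¬) renaming (_≟_ to _≟ᵇ_)
open import Data.Empty using (⊥-elim)
open import Data.Fin using (Fin; zero; suc)
open import Data.Fin.Properties using (any?)
open import Data.List as List using (List; []; _∷_; _++_; length)
open import Data.List.Membership.Propositional using (_∈_)
open import Data.List.Membership.Propositional.Properties using (∈-++⁺ˡ; ∈-++⁺ʳ)
open import Data.List.Relation.Binary.Subset.Propositional using (_⊆_)
open import Data.List.Relation.Unary.Any using (here; there; index)
open import Data.List.Relation.Unary.Any.Properties using (lookup-index)
open import Data.Nat using (ℕ; zero; suc) renaming (_≟_ to _≟ℕ_)
open import Data.Product using (Σ; ∃; ∃₂; _×_; _,_; proj₁; proj₂; curry; uncurry)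
open import Data.Product.Function.NonDependent.Propositional using (_×-⇔_)
import Data.Product.Properties as Product
open import Data.Sum using (_⊎_; inj₁; inj₂; swap)
open import Data.Unit using (tt)
open import Data.Vec as Vec using (Vec; []; _∷_; lookup; replicate)
import Data.Vec.Properties as Vec
open import Data.Vec.Relation.Binary.Pointwise.Extensional using (ext; Pointwise-≡⇒≡)
open import Effect.Monad using (RawMonad)
open import Function using (_∘_; id; const; _⇔_; mk⇔; Equivalence)
open import Function.Construct.Composition using (_⇔-∘_)
open import Function.Construct.Symmetry using (⇔-sym)
open import Function.Related.TypeIsomorphisms using (¬-cong-⇔)
open import Relation.Binary.PropositionalEquality using (_≡_; _≢_; refl; cong; cong₂; subst)
import Relation.Binary.PropositionalEquality as ≡
open import Relation.Nullary using (Dec; yes; no; ¬_; ¬?; _×-dec_; _→-dec_)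
open import Relation.Nullary.Decidable using (map′; T?; does-⇔; ¬¬-excluded-middle)
import Relation.Nullary.Decidable as Dec
open import Relation.Nullary.Negation using (¬¬-Monad; ¬¬-map; Stable; negated-stable)

open Equivalence using (to; from)
open RawMonad (¬¬-Monad {a = 0ℓ})

private
  variable
    n : ℕ
    A B : Set

characteristic : Dec A → Σ Bool λ b → T b ⇔ A
characteristic (yes a) = true , mk⇔ (const a) (const tt)
characteristic (no ¬a) = false , mk⇔ (λ ()) ¬a

characteristic-unique : ∀ {b c} → T b ⇔ A → T c ⇔ A → b ≡ c
characteristic-unique {b = b} {c} b⇔A c⇔A = does-⇔ (⇔-sym c⇔A ⇔-∘ b⇔A) (T? b) (T? c)

Exhaustible : Set → Set₁
Exhaustible A = {P : A → Set} → (∀ x → Dec (P x)) → Dec (∀ x → P x)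

Bool-exhaustible : Exhaustible Bool
Bool-exhaustible P? = map′ (λ (t , f) → λ { true → t ; false → f }) (λ h → h true , h false)
                           (P? true ×-dec P? false)

×-exhaustible : Exhaustible A → Exhaustible B → Exhaustible (A × B)
×-exhaustible ∀A? ∀B? P? = map′ uncurry curry (∀A? λ a → ∀B? λ b → P? (a , b))

Vec-exhaustible : Exhaustible A → ∀ n → Exhaustible (Vec A n)
Vec-exhaustible ∀A? zero    P? = map′ (λ { p [] → p }) (λ h → h []) (P? [])
Vec-exhaustible ∀A? (suc n) P? = map′ (λ { h (a ∷ v) → h a v }) (λ h a v → h (a ∷ v))
                                       (∀A? λ a → Vec-exhaustible ∀A? n λ v → P? (a ∷ v))

-- Functions Vec Bool n → B, tabulated as complete binary trees so that they can
-- be searched exhaustively.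
Table : ℕ → Set → Set
Table zero    B = B
Table (suc n) B = Table n B × Table n B

infixl 20 _!_
_!_ : Table n B → Vec Bool n → B
b       ! []          = b
(t , _) ! (true ∷ V)  = t ! V
(_ , f) ! (false ∷ V) = f ! V

Table-exhaustible : Exhaustible B → ∀ n → Exhaustible (Table n B)
Table-exhaustible ∀B? zero    = ∀B?
Table-exhaustible ∀B? (suc n) = ×-exhaustible (Table-exhaustible ∀B? n) (Table-exhaustible ∀B? n)

¬¬-tabulate : ∀ n {P : Fin n → B → Set} → (∀ k → ¬ ¬ Σ B (P k)) →
              ¬ ¬ Σ (Vec B n) λ v → ∀ k → P k (lookup v k)
¬¬-tabulate zero    h = return ([] , λ ())
¬¬-tabulate (suc n) h = do
  (b , p) ← h zero
  (v , q) ← ¬¬-tabulate n λ k → h (suc k)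
  return (b ∷ v , λ { zero → p ; (suc k) → q k })

¬¬-tabulateTable : ∀ n {P : Vec Bool n → B → Set} → (∀ V → ¬ ¬ Σ B (P V)) →
                   ¬ ¬ Σ (Table n B) λ t → ∀ V → P V (t ! V)
¬¬-tabulateTable zero h = do
  (b , p) ← h []
  return (b , λ { [] → p })
¬¬-tabulateTable (suc n) h = do
  (t , p) ← ¬¬-tabulateTable n λ V → h (true ∷ V)
  (f , q) ← ¬¬-tabulateTable n λ V → h (false ∷ V)
  return ((t , f) , λ { (true ∷ V) → p V ; (false ∷ V) → q V })

⊨-stable : ∀ (M : Model) w φ → Stable (M , w ⊨ φ)
⊨-stable M w (var p)   = negated-stable
⊨-stable M w (nom i)   = negated-stable
⊨-stable M w (neg φ)   = negated-stable
⊨-stable M w (and φ ψ) ¬¬φψ =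
  ⊨-stable M w φ (¬¬-map proj₁ ¬¬φψ) , ⊨-stable M w ψ (¬¬-map proj₂ ¬¬φψ)
⊨-stable M w (dia φ)   = negated-stable
⊨-stable M w (at i φ)  = ⊨-stable M (Model.nomV M i) φ

module _ (M : Model) where
  open Model M

  module _ (W-exhaustible : Exhaustible W) (_≟_ : (w v : W) → Dec (w ≡ v))
           (R? : ∀ w v → Dec (R w v)) (V? : ∀ p w → Dec (V p w)) where

    ⊨-dec : ∀ w φ → Dec (M , w ⊨ φ)
    ⊨-dec w (var p)   = ¬? (¬? (V? p w))
    ⊨-dec w (nom i)   = ¬? (¬? (w ≟ nomV i))
    ⊨-dec w (neg φ)   = ¬? (⊨-dec w φ)
    ⊨-dec w (and φ ψ) = ⊨-dec w φ ×-dec ⊨-dec w ψ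
    ⊨-dec w (dia φ)   = ¬? (map′ uncurry curry (W-exhaustible λ v → ¬? (R? w v ×-dec ⊨-dec v φ)))
    ⊨-dec w (at i φ)  = ⊨-dec (nomV i) φ

sub : Form → List Form
sub (var p)   = var p ∷ []
sub (nom i)   = nom i ∷ []
sub (neg φ)   = neg φ ∷ sub φ
sub (and φ ψ) = and φ ψ ∷ sub φ ++ sub ψ
sub (dia φ)   = dia φ ∷ sub φ
sub (at i φ)  = at i φ ∷ nom i ∷ sub φ

IsNominal : Form → Set
IsNominal φ = ∃ λ i → φ ≡ nom i

nominal? : (φ : Form) → Dec (IsNominal φ)
nominal? (var _)   = no λ ()
nominal? (nom i)   = yes (i , refl)
nominal? (neg _)   = no λ ()
nominal? (and _ _) = no λ ()
nominal? (dia _)   = no λ ()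
nominal? (at _ _)  = no λ ()

_≟var_ : (φ : Form) (p : Prop) → Dec (φ ≡ var p)
var q   ≟var p = map′ (cong var) (λ { refl → refl }) (q ≟ℕ p)
nom _   ≟var _ = no λ ()
neg _   ≟var _ = no λ ()
and _ _ ≟var _ = no λ ()
dia _   ≟var _ = no λ ()
at _ _  ≟var _ = no λ ()

_≟nom_ : (φ : Form) (i : Nom) → Dec (φ ≡ nom i)
var _   ≟nom _ = no λ ()
nom j   ≟nom i = map′ (cong nom) (λ { refl → refl }) (j ≟ℕ i)
neg _   ≟nom _ = no λ ()
and _ _ ≟nom _ = no λ ()
dia _   ≟nom _ = no λ ()
at _ _  ≟nom _ = no λ ()

module Closure (cl : List Form) where

  size : ℕ
  size = length cl

  formula : Fin size → Form
  formula = List.lookup cl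

  Valuation : Set
  Valuation = Vec Bool size

  _≟ᵛ_ : (V V′ : Valuation) → Dec (V ≡ V′)
  _≟ᵛ_ = Vec.≡-dec _≟ᵇ_

  Named : Valuation → Set
  Named V = ∃ λ k → T (lookup V k) × IsNominal (formula k)

  named? : (V : Valuation) → Dec (Named V)
  named? V = any? λ k → T? (lookup V k) ×-dec nominal? (formula k)

  MakesTrue : Prop → Valuation → Set
  MakesTrue p V = ∃ λ k → T (lookup V k) × formula k ≡ var p

  makesTrue? : ∀ p V → Dec (MakesTrue p V)
  makesTrue? p V = any? λ k → T? (lookup V k) ×-dec (formula k ≟var p)

  -- Nominals not occurring in cl are sent to an arbitrary valuation.
  denotation : Vec Valuation size → Nom → Valuation
  denotation names i with any? (λ k → formula k ≟nom i)
  ... | yes (k , _) = lookup names k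
  ... | no _        = replicate _ false

  World : Set
  World = Valuation × Bool

  _≟ʷ_ : (x y : World) → Dec (x ≡ y)
  _≟ʷ_ = Product.≡-dec _≟ᵛ_ _≟ᵇ_

  Good : World → Set
  Good (V , copy) = Named V → copy ≡ false

  good? : ∀ x → Dec (Good x)
  good? (V , copy) = named? V →-dec (copy ≟ᵇ false)

  freshCopy : ∀ x V → ¬ (Named V × proj₁ x ≡ V) → Σ Bool λ b → Good (V , b) × x ≢ (V , b)
  freshCopy (U , a) V ok with U ≟ᵛ V | named? V
  ... | no U≢V    | _         = false , const refl , U≢V ∘ cong proj₁
  ... | yes refl  | no ¬named = not a , ⊥-elim ∘ ¬named , not-¬ refl ∘ cong proj₂
  ... | yes U≡V   | yes named = ⊥-elim (ok (named , U≡V))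

  -- A table of links between valuations, and the valuation denoted by the nominal
  -- at each position of cl (entries at other positions are ignored).
  Skeleton : Set
  Skeleton = Table size (Table size Bool) × Vec Valuation size

  module SmallModel (edges : Table size (Table size Bool))
                    (names : Vec Valuation size) where

    Linked : Valuation → Valuation → Set
    Linked V V′ = T (edges ! V ! V′) ⊎ T (edges ! V′ ! V)

    _⟶_ : World → World → Set
    x ⟶ y = Good x × Good y × Linked (proj₁ x) (proj₁ y) × x ≢ y

    ⟶-dec : ∀ x y → Dec (x ⟶ y)
    ⟶-dec x y = good? x ×-dec good? y ×-dec
                (T? (edges ! proj₁ x ! proj₁ y) Dec.⊎-dec T? (edges ! proj₁ y ! proj₁ x)) ×-dec
                ¬? (x ≟ʷ y)

    model : Model
    model = record
      { W    = World
      ; w₀   = replicate _ false , false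
      ; R    = _⟶_
      ; V    = λ p x → MakesTrue p (proj₁ x)
      ; nomV = λ i → denotation names i , false
      }

    isOrtho : IsOrtho model
    isOrtho = record
      { irrefl = λ x (_ , _ , _ , x≢x) → x≢x refl
      ; sym    = λ (gx , gy , linked , x≢y) → gy , gx , swap linked , x≢y ∘ ≡.sym
      }

  small : Skeleton → Orthomodel
  small (edges , names) = record
    { model   = SmallModel.model edges names
    ; isOrtho = SmallModel.isOrtho edges names
    }

  World-exhaustible : Exhaustible World
  World-exhaustible = ×-exhaustible (Vec-exhaustible Bool-exhaustible size) Bool-exhaustible

  Skeleton-exhaustible : Exhaustible Skeleton
  Skeleton-exhaustible = ×-exhaustible (Table-exhaustible (Table-exhaustible Bool-exhaustible size) size)
                                       (Vec-exhaustible (Vec-exhaustible Bool-exhaustible size) size)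

  SmallValid : Form → Set
  SmallValid φ = ∀ s x → Orthomodel.model (small s) , x ⊨ φ

  smallValid? : ∀ φ → Dec (SmallValid φ)
  smallValid? φ = Skeleton-exhaustible λ (edges , names) → World-exhaustible λ x →
    ⊨-dec (SmallModel.model edges names) World-exhaustible _≟ʷ_
          (SmallModel.⟶-dec edges names) (λ p x → makesTrue? p (proj₁ x)) x φ

  module Types (M : Model) where
    open Model M

    record IsTypeOf (w : W) (V : Valuation) : Set where
      constructor mkType
      field entry : ∀ k → T (lookup V k) ⇔ M , w ⊨ formula k
    open IsTypeOf public

    ∃-typeOf : ∀ w → ¬ ¬ Σ Valuation (IsTypeOf w)
    ∃-typeOf w = ¬¬-map (λ (V , entries) → V , mkType entries)
                        (¬¬-tabulate size λ k → ¬¬-map characteristic ¬¬-excluded-middle)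

    typeOf-unique : ∀ {w V V′} → IsTypeOf w V → IsTypeOf w V′ → V ≡ V′
    typeOf-unique wV wV′ = Pointwise-≡⇒≡ (ext λ k → characteristic-unique (entry wV k) (entry wV′ k))

    typeOf-∈ : ∀ {w V ψ} → IsTypeOf w V → (m : ψ ∈ cl) → T (lookup V (index m)) ⇔ M , w ⊨ ψ
    typeOf-∈ {w} {V} wV m =
      subst (λ χ → T (lookup V (index m)) ⇔ M , w ⊨ χ) (≡.sym (lookup-index m)) (entry wV (index m))

    typeOf-transfer : ∀ {v u V ψ} → IsTypeOf v V → IsTypeOf u V → ψ ∈ cl → M , u ⊨ ψ → M , v ⊨ ψ
    typeOf-transfer vV uV m = to (typeOf-∈ vV m) ∘ from (typeOf-∈ uV m)

    typeOf-named : ∀ {v V ψ} → IsTypeOf v V → ψ ∈ cl → IsNominal ψ → M , v ⊨ ψ → Named V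
    typeOf-named vV m (i , ψ≡i) v⊨ψ =
      index m , from (typeOf-∈ vV m) v⊨ψ , i , ≡.trans (≡.sym (lookup-index m)) ψ≡i

    named-realiser-unique : ∀ {v u V} → IsTypeOf v V → IsTypeOf u V → Named V → ¬ ¬ (v ≡ u)
    named-realiser-unique {v} {u} vV uV (k , Vk , i , k≡i) = do
      v≡i ← subst (M , v ⊨_) k≡i (to (entry vV k) Vk)
      u≡i ← subst (M , u ⊨_) k≡i (to (entry uV k) Vk)
      return (≡.trans v≡i (≡.sym u≡i))

  module Filtration (M : Orthomodel) where
    open Orthomodel M using (W; R; nomV; isOrtho) renaming (model to 𝓜)
    open IsOrtho isOrtho using (irrefl) renaming (sym to R-sym)
    open Types 𝓜

    RealisedEdge : Valuation → Valuation → Set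
    RealisedEdge V V′ = ∃₂ λ v u → IsTypeOf v V × IsTypeOf u V′ × R v u

    Faithful : Skeleton → Set
    Faithful (edges , names) =
      (∀ V V′ → T (edges ! V ! V′) ⇔ RealisedEdge V V′) ×
      (∀ k i → formula k ≡ nom i → IsTypeOf (nomV i) (lookup names k))

    ∃-faithful : ¬ ¬ Σ Skeleton Faithful
    ∃-faithful = do
      (edges , edges-ok) ← ¬¬-tabulateTable size λ V → ¬¬-tabulateTable size λ V′ →
                              ¬¬-map characteristic ¬¬-excluded-middle
      (names , names-ok) ← ¬¬-tabulate size λ k → ∃-nominalType (formula k)
      return ((edges , names) , edges-ok , names-ok)
      where
      ∃-nominalType : ∀ ψ → ¬ ¬ Σ Valuation λ V → ∀ i → ψ ≡ nom i → IsTypeOf (nomV i) V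
      ∃-nominalType ψ with nominal? ψ
      ... | yes (j , refl) = ¬¬-map (λ (V , jV) → V , λ { _ refl → jV }) (∃-typeOf (nomV j))
      ... | no ¬nominal    = return (replicate size false , λ i ψ≡i → ⊥-elim (¬nominal (i , ψ≡i)))

    module Truth (edges : Table size (Table size Bool)) (names : Vec Valuation size)
                 (faithful : Faithful (edges , names)) where
      open SmallModel edges names using (Linked; _⟶_) renaming (model to 𝒮)

      denotation-typeOf : ∀ {i} → nom i ∈ cl → IsTypeOf (nomV i) (denotation names i)
      denotation-typeOf {i} m with any? (λ k → formula k ≟nom i)
      ... | yes (k , k≡i) = proj₂ faithful k i k≡i
      ... | no ∄k         = ⊥-elim (∄k (index m , ≡.sym (lookup-index m)))

      linked-realised : ∀ {V U} → Linked V U → RealisedEdge V U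
      linked-realised (inj₁ e) = to (proj₁ faithful _ _) e
      linked-realised (inj₂ e) with to (proj₁ faithful _ _) e
      ... | u , v , uU , vV , uRv = v , u , vV , uU , R-sym uRv

      Preserved : Form → Set
      Preserved ψ = ∀ {v V c} → IsTypeOf v V → Good (V , c) → (𝒮 , (V , c) ⊨ ψ) ⇔ (𝓜 , v ⊨ ψ)

      var-preserved : ∀ {p} → var p ∈ cl → Preserved (var p)
      var-preserved m vV _ = mk⇔
        (λ h → h >>= λ (k , Vk , k≡p) → subst (𝓜 , _ ⊨_) k≡p (to (entry vV k) Vk))
        (λ v⊨p → return (index m , from (typeOf-∈ vV m) v⊨p , ≡.sym (lookup-index m)))

      nom-preserved : ∀ {i} → nom i ∈ cl → Preserved (nom i)
      nom-preserved {i} m vV good = mk⇔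
        (λ h → h >>= λ Vc≡i →
           typeOf-transfer vV (subst (IsTypeOf (nomV i)) (≡.sym (cong proj₁ Vc≡i)) iT) m (return refl))
        (λ v⊨i → v⊨i >>= λ v≡i → return (cong₂ _,_
           (typeOf-unique vV (subst (λ w → IsTypeOf w _) (≡.sym v≡i) iT))
           (good (typeOf-named vV m (i , refl) v⊨i))))
        where iT = denotation-typeOf m

      dia-preserved : ∀ {ψ} → dia ψ ∈ cl → Preserved ψ → Preserved (dia ψ)
      dia-preserved {ψ} m ψ-preserved {v} {V} {c} vV good = mk⇔ (_>>= forth) (_>>= back)
        where
        forth : Σ World (λ y → (V , c) ⟶ y × 𝒮 , y ⊨ ψ) → 𝓜 , v ⊨ dia ψ
        forth ((U , b) , (_ , goodU , linked , _) , y⊨ψ) with linked-realised linked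
        ... | v′ , u , v′V , uU , v′Ru =
          typeOf-transfer vV v′V m (return (u , v′Ru , to (ψ-preserved uU goodU) y⊨ψ))

        back : Σ W (λ u → R v u × 𝓜 , u ⊨ ψ) → 𝒮 , (V , c) ⊨ dia ψ
        back (u , vRu , u⊨ψ) = do
          (U , uU) ← ∃-typeOf u
          let (b , goodU , distinct) = freshCopy (V , c) U λ (named , V≡U) →
                named-realiser-unique (subst (IsTypeOf v) V≡U vV) uU named
                  λ v≡u → irrefl u (subst (λ w → R w u) v≡u vRu)
              linked = inj₁ (from (proj₁ faithful V U) (v , u , vV , uU , vRu))
          return ((U , b) , (good , goodU , linked , distinct) , from (ψ-preserved uU goodU) u⊨ψ)

      truth : ∀ ψ → sub ψ ⊆ cl → Preserved ψ
      truth (var p)   sb = var-preserved (sb (here refl))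
      truth (nom i)   sb = nom-preserved (sb (here refl))
      truth (neg ψ)   sb vV good = ¬-cong-⇔ (truth ψ (sb ∘ there) vV good)
      truth (and ψ χ) sb vV good =
        truth ψ (sb ∘ there ∘ ∈-++⁺ˡ) vV good ×-⇔ truth χ (sb ∘ there ∘ ∈-++⁺ʳ (sub ψ)) vV good
      truth (dia ψ)   sb = dia-preserved (sb (here refl)) (truth ψ (sb ∘ there))
      truth (at i ψ)  sb _ _ =
        truth ψ (sb ∘ there ∘ there) (denotation-typeOf (sb (there (here refl)))) (const refl)

    smallValid⇒valid : ∀ φ → sub φ ⊆ cl → SmallValid φ → ∀ w → 𝓜 , w ⊨ φ
    smallValid⇒valid φ sb valid w = ⊨-stable 𝓜 w φ do
      ((edges , names) , faithful) ← ∃-faithful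
      (V , wV) ← ∃-typeOf w
      return (to (Truth.truth edges names faithful φ sb wV (const refl)) (valid _ (V , false)))

finite-model-property : ∀ φ → Closure.SmallValid (sub φ) φ ⇔ IBValid φ
finite-model-property φ = mk⇔
  (λ valid M → Filtration.smallValid⇒valid M φ id valid)
  (λ valid s → valid (small s))
  where open Closure (sub φ)

corollary1 : (φ : Form) → Dec (IBValid φ)
corollary1 φ = Dec.map (finite-model-property φ) (Closure.smallValid? (sub φ) φ)
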